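{- Let $n>2$ be an integer (odd or even) and $q\in\mathcal{B}_n$ with $wt(q)\in\{2,3\}$. Then there are no non-linear (balanced) $q$-nearly bent functions in $\mathcal{B}_n$.
   Context: $V_n=\{0,1\}^n$ (row vectors) and $\mathcal{B}_n$ is the set of Boolean functions $V_n\to\{0,1\}$. $wt(f)=|\{a: f(a)=1\}|$; $f$ is balanced if $wt(f)=2^{n-1}$. "Non-linear" means not affine (algebraic degree at least 2). $W(f,g)=\sum_{a\in V_n}(-1)^{f(a)+g(a)}$. $GL_n$ is the group of invertible $n\times n$ matrices over $\mathbb{F}_2$; $q_A(a)=q(aA)$; $W_q(f)(A)=W(f,q_A)$. $I_q=\sum_{a\in V_n}(-1)^{q(a)}$ and $\rho_q=\left\lceil\left(\frac{2^{2n}-I_q^2}{2^n-1}\right)^{1/2}\right\rceil$. A balanced $f\in\mathcal{B}_n$ is called $q$-nearly bent if $|W_q(f)(A)|\le\rho_q$ for all $A\in GL_n$. -}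

module Defs where

open import Data.Bool using (Bool; true; false; _xor_; _∧_; if_then_else_)
open import Data.Nat using (ℕ; zero; suc; _+_; _*_; _∸_; _^_; _≤_; _≤ᵇ_)
open import Data.Integer as ℤ using (ℤ; ∣_∣)
open import Data.Fin using (Fin)
open import Data.Fin.Properties using () renaming (_≟_ to _≟ᶠ_)
open import Data.Vec using (Vec; []; _∷_; lookup; tabulate; zipWith; foldr)
open import Data.List as List using (List; []; _∷_; _++_; length; filter)
open import Data.Product using (Σ; ∃; _×_; _,_)
open import Relation.Nullary using (¬_; does)
open import Relation.Binary.PropositionalEquality using (_≡_)

-- V_n = {0,1}^n as row vectors (false = 0, true = 1)
V : ℕ → Set
V n = Vec Bool n

BF : ℕ → Set
BF n = V n → Bool

allV : (n : ℕ) → List (V n)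
allV zero = [] ∷ []
allV (suc n) = List.map (false ∷_) (allV n) ++ List.map (true ∷_) (allV n)

wt : ∀ {n} → BF n → ℕ
wt {n} f = length (filter (λ a → f a Data.Bool.≟ true) (allV n))

balanced : ∀ {n} → BF n → Set
balanced {n} f = 2 * wt f ≡ 2 ^ n

dot : ∀ {n} → V n → V n → Bool
dot a b = foldr _ _xor_ false (zipWith _∧_ a b)

-- affine functions a ↦ b ⊕ c·a ; "non-linear" = not affine
affine : ∀ {n} → BF n → Set
affine {n} f = Σ (V n) λ c → Σ Bool λ b → ∀ (a : V n) → f a ≡ b xor dot c a

Mat : ℕ → Set
Mat n = Fin n → Fin n → Bool

column : ∀ {n} → Mat n → Fin n → V n
column A j = tabulate λ i → A i j

row : ∀ {n} → Mat n → Fin n → V n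
row A i = tabulate λ j → A i j

_·ₘ_ : ∀ {n} → Mat n → Mat n → Mat n
(A ·ₘ B) i j = dot (row A i) (column B j)

idMat : ∀ {n} → Mat n
idMat i j = does (i ≟ᶠ j)

InGL : ∀ {n} → Mat n → Set
InGL {n} A = Σ (Mat n) λ B →
  (∀ i j → (A ·ₘ B) i j ≡ idMat i j) × (∀ i j → (B ·ₘ A) i j ≡ idMat i j)

vecMat : ∀ {n} → V n → Mat n → V n
vecMat a A = tabulate λ j → dot a (column A j)

compose : ∀ {n} → BF n → Mat n → BF n
compose q A a = q (vecMat a A)

sign : Bool → ℤ
sign false = ℤ.+ 1
sign true  = ℤ.- (ℤ.+ 1)

sumℤ : List ℤ → ℤ
sumℤ = List.foldr ℤ._+_ (ℤ.+ 0)

W : ∀ {n} → BF n → BF n → ℤ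
W {n} f g = sumℤ (List.map (λ a → sign (f a xor g a)) (allV n))

Wq : ∀ {n} → BF n → BF n → Mat n → ℤ
Wq q f A = W f (compose q A)

Iq : ∀ {n} → BF n → ℤ
Iq {n} q = sumℤ (List.map (λ a → sign (q a)) (allV n))

-- least r ≤ bound (searching upward from r) with N ≤ D * r * r;
-- returns the bound if none found
ceilSqrtSearch : (N D r fuel : ℕ) → ℕ
ceilSqrtSearch N D r zero = r
ceilSqrtSearch N D r (suc fuel) =
  if N ≤ᵇ D * r * r then r else ceilSqrtSearch N D (suc r) fuel

-- ceil( sqrt(N / D) ) for D ≥ 1: least r with N ≤ D r²
-- (r = N always works when D ≥ 1, so fuel N suffices)
ceilSqrtRatio : (N D : ℕ) → ℕ
ceilSqrtRatio N D = ceilSqrtSearch N D 0 N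

-- ρ_q = ⌈ ((2^{2n} - I_q²)/(2^n - 1))^{1/2} ⌉  (note |I_q| ≤ 2^n, so ∸ is exact)
ρ : ∀ {n} → BF n → ℕ
ρ {n} q = ceilSqrtRatio (2 ^ (2 * n) ∸ ∣ Iq q ∣ * ∣ Iq q ∣) (2 ^ n ∸ 1)

qNearlyBent : ∀ {n} → BF n → BF n → Set
qNearlyBent {n} q f = balanced f × (∀ (A : Mat n) → InGL A → ∣ Wq q f A ∣ ≤ ρ q)

-- Let T be the support of q. Since f is balanced, W(f, h) = -2 Σ_{t ∈ T′} (-1)^{f(t)} whenever h is
-- the indicator of a set T′, and q_A is the indicator of the image of T under A⁻¹. For 2ⁿ ≥ 8 one
-- has ρ_q ≤ 3 when |T| = 2 and ρ_q ≤ 5 when |T| = 3, while a set T′ of that size on which f is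
-- constant gives |W| = 4, resp. 6. So f would have to be non-constant on every image of T under
-- GL_n. Transvections act transitively on nonzero vectors, on pairs of distinct nonzero vectors
-- and on linearly independent triples; hence, depending on the shape of T, f either separates 0
-- from all (or all but one) nonzero vectors, which contradicts balancedness, or is non-constant
-- on every pair, every line {u, v, u ⊕ v} or every basis triple, which already fails on the
-- 7 nonzero points of a 3-dimensional subspace (the Fano plane).
module Submission where

open import Defs

open import Algebra.Bundles using (CommutativeRing)
open import Data.Bool using (Bool; true; false; not; _xor_; _∧_; if_then_else_; T)
open import Data.Bool.Properties using (xor-assoc; xor-comm; xor-same; xor-identityˡ; xor-identityʳ; ∧-assoc; ∧-zeroʳ; ∧-identityʳ; ∧-distribˡ-xor; ∧-distribʳ-xor; xor-∧-commutativeRing; not-involutive; ¬-not) renaming (_≟_ to _≟ᵇ_)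
open import Data.Empty using (⊥; ⊥-elim)
open import Data.Fin using (Fin; zero; suc)
open import Data.Fin.Properties using () renaming (_≟_ to _≟ᶠ_)
open import Data.Integer as ℤ using (ℤ; +_; 0ℤ; -_; _+_; _-_; _*_; ∣_∣)
import Data.Integer.Properties as ℤ
import Data.Integer.Tactic.RingSolver as ℤ-Solver
open import Data.List as List using (List; []; _∷_; _++_; length; filter; map; cartesianProduct; allFin)
open import Data.List.Properties using (map-++; map-∘; map-cong; map-cong-local; length-map; length-++)
open import Data.List.Membership.Propositional using (_∈_; _∉_; lose)
open import Data.List.Membership.Propositional.Properties using (∈-filter⁺; ∈-filter⁻; ∈-map⁺; ∈-map⁻; ∈-++⁺ˡ; ∈-++⁺ʳ)
open import Data.List.Relation.Binary.Permutation.Propositional as ↭ using (_↭_; ↭-sym)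
open import Data.List.Relation.Binary.Permutation.Propositional.Properties using (∈-resp-↭)
open import Data.List.Relation.Unary.All as All using (All; []; _∷_; all?)
open import Data.List.Relation.Unary.Any using (Any; here; there; any?; satisfied)
open import Data.List.Relation.Unary.AllPairs using ([]; _∷_)
open import Data.List.Relation.Unary.Unique.Propositional using (Unique)
import Data.List.Relation.Unary.Unique.Propositional.Properties as Unique
open import Data.Nat as ℕ using (ℕ; zero; suc; _^_; _≤_; _<_; _≤ᵇ_; _∸_; z≤n; s≤s)
import Data.Nat.Properties as ℕ
import Data.Nat.Tactic.RingSolver as ℕ-Solver
open import Data.Product using (∃-syntax; _×_; _,_; proj₁; proj₂)
open import Data.Sum using (_⊎_; [_,_])
open import Data.Vec as Vec using (Vec; []; _∷_; lookup; tabulate; zipWith; replicate)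
open import Data.Vec.Properties using (≡-dec; zipWith-assoc; zipWith-identityˡ; zipWith-identityʳ; zipWith-++; ++-injectiveˡ; lookup∘tabulate; lookup-zipWith; tabulate-cong)
open import Data.Vec.Relation.Binary.Pointwise.Extensional using (ext; Pointwise-≡⇒≡)
open import Function using (_∘_; _⇔_; mk⇔)
open import Relation.Binary.Definitions using (DecidableEquality)
open import Relation.Binary.PropositionalEquality using (_≡_; _≢_; _≗_; refl; sym; trans; cong; cong₂; subst; subst₂; module ≡-Reasoning)
open import Relation.Nullary using (¬_; Dec; does; yes; no; ¬?; _×-dec_; contradiction)
open import Relation.Nullary.Decidable using (dec-true; dec-false; does-⇔; from-yes)
open import Relation.Unary using (Decidable)

open import Algebra.Properties.CommutativeSemigroup (CommutativeRing.+-commutativeSemigroup xor-∧-commutativeRing) using () renaming (interchange to xor-interchange)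
open import Algebra.Properties.CommutativeSemigroup ℤ.+-commutativeSemigroup using () renaming (interchange to +-interchange)
open import Algebra.Properties.Semiring.Sum (CommutativeRing.semiring xor-∧-commutativeRing) using (sum-syntax; ∑-comm; ∑-distrib-+; *-distribˡ-sum; *-distribʳ-sum; sum-cong-≗; sum-replicate-zero)

variable
  n : ℕ

-- Vectors over 𝔽₂
xor-cancelˡ : ∀ b c → b xor (b xor c) ≡ c
xor-cancelˡ false c = refl
xor-cancelˡ true c = not-involutive c

infixl 6 _⊕_
infix 4 _≟ᵥ_

_⊕_ : V n → V n → V n
_⊕_ = zipWith _xor_

0v : V n
0v = replicate _ false

_≟ᵥ_ : DecidableEquality (V n)
_≟ᵥ_ = ≡-dec _≟ᵇ_

lookup-ext : {u v : V n} → (∀ i → lookup u i ≡ lookup v i) → u ≡ v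
lookup-ext = Pointwise-≡⇒≡ ∘ ext

⊕-assoc : (u v w : V n) → (u ⊕ v) ⊕ w ≡ u ⊕ (v ⊕ w)
⊕-assoc = zipWith-assoc xor-assoc

⊕-identityˡ : (u : V n) → 0v ⊕ u ≡ u
⊕-identityˡ = zipWith-identityˡ xor-identityˡ

⊕-identityʳ : (u : V n) → u ⊕ 0v ≡ u
⊕-identityʳ = zipWith-identityʳ xor-identityʳ

⊕-comm : (u v : V n) → u ⊕ v ≡ v ⊕ u
⊕-comm [] [] = refl
⊕-comm (x ∷ u) (y ∷ v) = cong₂ _∷_ (xor-comm x y) (⊕-comm u v)

⊕-self : (u : V n) → u ⊕ u ≡ 0v
⊕-self [] = refl
⊕-self (x ∷ u) = cong₂ _∷_ (xor-same x) (⊕-self u)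

⊕-interchange : (u v w z : V n) → (u ⊕ v) ⊕ (w ⊕ z) ≡ (u ⊕ w) ⊕ (v ⊕ z)
⊕-interchange [] [] [] [] = refl
⊕-interchange (a ∷ u) (b ∷ v) (c ∷ w) (d ∷ z) = cong₂ _∷_ (xor-interchange a b c d) (⊕-interchange u v w z)

⊕-cancelʳ : (u v : V n) → (u ⊕ v) ⊕ v ≡ u
⊕-cancelʳ u v = trans (⊕-assoc u v v) (trans (cong (u ⊕_) (⊕-self v)) (⊕-identityʳ u))

⊕-cancelˡ : (u v : V n) → u ⊕ (u ⊕ v) ≡ v
⊕-cancelˡ u v = trans (sym (⊕-assoc u u v)) (trans (cong (_⊕ v) (⊕-self u)) (⊕-identityˡ v))

⊕-swapʳ : (u v w : V n) → (u ⊕ v) ⊕ w ≡ (u ⊕ w) ⊕ v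
⊕-swapʳ u v w = begin
  (u ⊕ v) ⊕ w ≡⟨ ⊕-assoc u v w ⟩
  u ⊕ (v ⊕ w) ≡⟨ cong (u ⊕_) (⊕-comm v w) ⟩
  u ⊕ (w ⊕ v) ≡⟨ ⊕-assoc u w v ⟨
  (u ⊕ w) ⊕ v ∎
  where open ≡-Reasoning

⊕-cancel-common : (u v w : V n) → (u ⊕ w) ⊕ (v ⊕ w) ≡ u ⊕ v
⊕-cancel-common u v w = begin
  (u ⊕ w) ⊕ (v ⊕ w) ≡⟨ ⊕-interchange u w v w ⟩
  (u ⊕ v) ⊕ (w ⊕ w) ≡⟨ cong ((u ⊕ v) ⊕_) (⊕-self w) ⟩
  (u ⊕ v) ⊕ 0v      ≡⟨ ⊕-identityʳ (u ⊕ v) ⟩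
  u ⊕ v             ∎
  where open ≡-Reasoning

⊕≡0⇒≡ : {u v : V n} → u ⊕ v ≡ 0v → u ≡ v
⊕≡0⇒≡ {u = u} {v} eq = trans (sym (⊕-cancelʳ u v)) (trans (cong (_⊕ v) eq) (⊕-identityˡ v))

≢-⊕ʳ : {u v : V n} → v ≢ 0v → u ≢ u ⊕ v
≢-⊕ʳ {u = u} {v} v≢0 u≡u⊕v = v≢0 (trans (sym (⊕-cancelˡ u v)) (trans (cong (u ⊕_) (sym u≡u⊕v)) (⊕-self u)))

≢-⊕ˡ : {u v : V n} → u ≢ 0v → v ≢ u ⊕ v
≢-⊕ˡ {u = u} {v} u≢0 v≡u⊕v = u≢0 (trans (sym (⊕-cancelʳ u v)) (trans (cong (_⊕ v) (sym v≡u⊕v)) (⊕-self v)))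

dot-0ˡ : (a : V n) → dot 0v a ≡ false
dot-0ˡ [] = refl
dot-0ˡ (x ∷ a) = dot-0ˡ a

dot-0ʳ : (a : V n) → dot a 0v ≡ false
dot-0ʳ [] = refl
dot-0ʳ (x ∷ a) = trans (cong (_xor dot a 0v) (∧-zeroʳ x)) (dot-0ʳ a)

dot-⊕ˡ : (u v a : V n) → dot (u ⊕ v) a ≡ dot u a xor dot v a
dot-⊕ˡ [] [] [] = refl
dot-⊕ˡ (x ∷ u) (y ∷ v) (z ∷ a) =
  trans (cong₂ _xor_ (∧-distribʳ-xor z x y) (dot-⊕ˡ u v a)) (xor-interchange (x ∧ z) (y ∧ z) _ _)

dot-⊕ʳ : (a u v : V n) → dot a (u ⊕ v) ≡ dot a u xor dot a v
dot-⊕ʳ [] [] [] = refl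
dot-⊕ʳ (z ∷ a) (x ∷ u) (y ∷ v) =
  trans (cong₂ _xor_ (∧-distribˡ-xor z x y) (dot-⊕ʳ a u v)) (xor-interchange (z ∧ x) (z ∧ y) _ _)

dot-⊕ˡ-≡ : (u v a : V n) {b c : Bool} → dot u a ≡ b → dot v a ≡ c → dot (u ⊕ v) a ≡ b xor c
dot-⊕ˡ-≡ u v a ua vb = trans (dot-⊕ˡ u v a) (cong₂ _xor_ ua vb)

dot-⊕ʳ-≡ : (v a a′ : V n) {b c : Bool} → dot v a ≡ b → dot v a′ ≡ c → dot v (a ⊕ a′) ≡ b xor c
dot-⊕ʳ-≡ v a a′ va va′ = trans (dot-⊕ʳ v a a′) (cong₂ _xor_ va va′)

dot-by-⊕ : (u v a : V n) → dot v a ≡ dot u a xor dot (u ⊕ v) a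
dot-by-⊕ u v a = trans (sym (xor-cancelˡ (dot u a) (dot v a))) (cong (dot u a xor_) (sym (dot-⊕ˡ u v a)))

dot-as-sum : (u v : V n) → dot u v ≡ ∑[ i < n ] (lookup u i ∧ lookup v i)
dot-as-sum [] [] = refl
dot-as-sum (x ∷ u) (y ∷ v) = cong ((x ∧ y) xor_) (dot-as-sum u v)

∑-δˡ : (g : Fin n → Bool) (i : Fin n) → ∑[ k < n ] (does (i ≟ᶠ k) ∧ g k) ≡ g i
∑-δˡ {suc n} g zero = trans (cong (g zero xor_) (sum-replicate-zero n)) (xor-identityʳ (g zero))
∑-δˡ {suc n} g (suc i) = ∑-δˡ (g ∘ suc) i

∑-δʳ : (g : Fin n → Bool) (j : Fin n) → ∑[ k < n ] (g k ∧ does (k ≟ᶠ j)) ≡ g j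
∑-δʳ {suc n} g zero =
  trans (cong₂ _xor_ (∧-identityʳ (g zero)) (trans (sum-cong-≗ (∧-zeroʳ ∘ g ∘ suc)) (sum-replicate-zero n)))
        (xor-identityʳ (g zero))
∑-δʳ {suc n} g (suc j) =
  trans (cong (_xor ∑[ k < n ] (g (suc k) ∧ does (k ≟ᶠ j))) (∧-zeroʳ (g zero))) (∑-δʳ (g ∘ suc) j)

-- Matrices over 𝔽₂
vecMat-lookup : (v : V n) (A : Mat n) (j : Fin n) → lookup (vecMat v A) j ≡ ∑[ i < n ] (lookup v i ∧ A i j)
vecMat-lookup v A j = begin
  lookup (vecMat v A) j
    ≡⟨ lookup∘tabulate (λ j → dot v (column A j)) j ⟩
  dot v (column A j)
    ≡⟨ dot-as-sum v (column A j) ⟩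
  ∑[ i < _ ] (lookup v i ∧ lookup (column A j) i)
    ≡⟨ sum-cong-≗ (λ i → cong (lookup v i ∧_) (lookup∘tabulate (λ i → A i j) i)) ⟩
  ∑[ i < _ ] (lookup v i ∧ A i j) ∎
  where open ≡-Reasoning

·ₘ-lookup : (A B : Mat n) (i j : Fin n) → (A ·ₘ B) i j ≡ ∑[ k < n ] (A i k ∧ B k j)
·ₘ-lookup A B i j = trans (sym (lookup∘tabulate (λ j → dot (row A i) (column B j)) j))
  (trans (vecMat-lookup (row A i) B j) (sum-cong-≗ (λ k → cong (_∧ B k j) (lookup∘tabulate (A i) k))))

vecMat-assoc : (v : V n) (A B : Mat n) → vecMat v (A ·ₘ B) ≡ vecMat (vecMat v A) B
vecMat-assoc {n} v A B = lookup-ext λ j → begin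
  lookup (vecMat v (A ·ₘ B)) j
    ≡⟨ vecMat-lookup v (A ·ₘ B) j ⟩
  ∑[ i < n ] (lookup v i ∧ (A ·ₘ B) i j)
    ≡⟨ sum-cong-≗ (λ i → cong (lookup v i ∧_) (·ₘ-lookup A B i j)) ⟩
  ∑[ i < n ] (lookup v i ∧ ∑[ k < n ] (A i k ∧ B k j))
    ≡⟨ sum-cong-≗ (λ i → *-distribˡ-sum (lookup v i) (λ k → A i k ∧ B k j)) ⟩
  ∑[ i < n ] ∑[ k < n ] (lookup v i ∧ (A i k ∧ B k j))
    ≡⟨ ∑-comm (λ i k → lookup v i ∧ (A i k ∧ B k j)) ⟩
  ∑[ k < n ] ∑[ i < n ] (lookup v i ∧ (A i k ∧ B k j))
    ≡⟨ sum-cong-≗ (λ k → sum-cong-≗ (λ i → sym (∧-assoc (lookup v i) (A i k) (B k j)))) ⟩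
  ∑[ k < n ] ∑[ i < n ] ((lookup v i ∧ A i k) ∧ B k j)
    ≡⟨ sum-cong-≗ (λ k → sym (*-distribʳ-sum (B k j) (λ i → lookup v i ∧ A i k))) ⟩
  ∑[ k < n ] (∑[ i < n ] (lookup v i ∧ A i k) ∧ B k j)
    ≡⟨ sum-cong-≗ (λ k → cong (_∧ B k j) (sym (vecMat-lookup v A k))) ⟩
  ∑[ k < n ] (lookup (vecMat v A) k ∧ B k j)
    ≡⟨ vecMat-lookup (vecMat v A) B j ⟨
  lookup (vecMat (vecMat v A) B) j ∎
  where open ≡-Reasoning

vecMat-identity : (v : V n) → vecMat v idMat ≡ v
vecMat-identity v = lookup-ext λ j → trans (vecMat-lookup v idMat j) (∑-δʳ (lookup v) j)

vecMat-row : (A : Mat n) (i : Fin n) → vecMat (row idMat i) A ≡ row A i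
vecMat-row A i = lookup-ext λ j → begin
  lookup (vecMat (row idMat i) A) j               ≡⟨ vecMat-lookup (row idMat i) A j ⟩
  ∑[ k < _ ] (lookup (row idMat i) k ∧ A k j)     ≡⟨ sum-cong-≗ (λ k → cong (_∧ A k j) (lookup∘tabulate (idMat i) k)) ⟩
  ∑[ k < _ ] (idMat i k ∧ A k j)                  ≡⟨ ∑-δˡ (λ k → A k j) i ⟩
  A i j                                           ≡⟨ lookup∘tabulate (A i) j ⟨
  lookup (row A i) j                              ∎
  where open ≡-Reasoning

vecMat-cong : (v : V n) {A B : Mat n} → (∀ i j → A i j ≡ B i j) → vecMat v A ≡ vecMat v B
vecMat-cong v A≡B = tabulate-cong (λ j → cong (dot v) (tabulate-cong (λ i → A≡B i j)))

·ₘ-inverse⇒vecMat-inverse : {A B : Mat n} → (∀ i j → (A ·ₘ B) i j ≡ idMat i j) → ∀ v → vecMat (vecMat v A) B ≡ v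
·ₘ-inverse⇒vecMat-inverse {A = A} {B} AB≡1 v =
  trans (sym (vecMat-assoc v A B)) (trans (vecMat-cong v AB≡1) (vecMat-identity v))

vecMat-inverse⇒·ₘ-inverse : {A B : Mat n} → (∀ v → vecMat (vecMat v A) B ≡ v) → ∀ i j → (A ·ₘ B) i j ≡ idMat i j
vecMat-inverse⇒·ₘ-inverse {A = A} {B} B∘A≡id i j = begin
  (A ·ₘ B) i j                                ≡⟨ lookup∘tabulate (λ j → dot (row A i) (column B j)) j ⟨
  lookup (vecMat (row A i) B) j               ≡⟨ cong (λ r → lookup (vecMat r B) j) (vecMat-row A i) ⟨
  lookup (vecMat (vecMat (row idMat i) A) B) j ≡⟨ cong (λ r → lookup r j) (B∘A≡id (row idMat i)) ⟩
  lookup (row idMat i) j                      ≡⟨ lookup∘tabulate (idMat i) j ⟩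
  idMat i j                                   ∎
  where open ≡-Reasoning

vecMat-inverse-·ₘ : {A A′ B B′ : Mat n} →
                    (∀ v → vecMat (vecMat v A) A′ ≡ v) → (∀ v → vecMat (vecMat v B) B′ ≡ v) →
          ∀ v → vecMat (vecMat v (A ·ₘ B)) (B′ ·ₘ A′) ≡ v
vecMat-inverse-·ₘ {A = A} {A′} {B} {B′} A′∘A≡id B′∘B≡id v = begin
  vecMat (vecMat v (A ·ₘ B)) (B′ ·ₘ A′)          ≡⟨ cong (λ u → vecMat u (B′ ·ₘ A′)) (vecMat-assoc v A B) ⟩
  vecMat (vecMat (vecMat v A) B) (B′ ·ₘ A′)      ≡⟨ vecMat-assoc (vecMat (vecMat v A) B) B′ A′ ⟩
  vecMat (vecMat (vecMat (vecMat v A) B) B′) A′  ≡⟨ cong (λ u → vecMat u A′) (B′∘B≡id (vecMat v A)) ⟩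
  vecMat (vecMat v A) A′                         ≡⟨ A′∘A≡id v ⟩
  v                                              ∎
  where open ≡-Reasoning

InGL-·ₘ : {A B : Mat n} → InGL A → InGL B → InGL (A ·ₘ B)
InGL-·ₘ (A⁻¹ , AA⁻¹ , A⁻¹A) (B⁻¹ , BB⁻¹ , B⁻¹B) = B⁻¹ ·ₘ A⁻¹ ,
  vecMat-inverse⇒·ₘ-inverse (vecMat-inverse-·ₘ (·ₘ-inverse⇒vecMat-inverse AA⁻¹) (·ₘ-inverse⇒vecMat-inverse BB⁻¹)) ,
  vecMat-inverse⇒·ₘ-inverse (vecMat-inverse-·ₘ (·ₘ-inverse⇒vecMat-inverse B⁻¹B) (·ₘ-inverse⇒vecMat-inverse A⁻¹A))

InGL-idMat : InGL (idMat {n})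
InGL-idMat = idMat , 1·1≡1 , 1·1≡1
  where
  1·1≡1 : ∀ i j → (idMat ·ₘ idMat) i j ≡ idMat {n} i j
  1·1≡1 = vecMat-inverse⇒·ₘ-inverse (λ v → trans (vecMat-identity (vecMat v idMat)) (vecMat-identity v))

-- Transvections
record Transvection (n : ℕ) : Set where
  constructor transvection
  field
    functional direction : V n
    direction-in-kernel : dot direction functional ≡ false
open Transvection

apply : Transvection n → V n → V n
apply t v = if dot v (functional t) then v ⊕ direction t else v

apply-fix : (t : Transvection n) (v : V n) → dot v (functional t) ≡ false → apply t v ≡ v
apply-fix t v va≡0 rewrite va≡0 = refl

apply-move : (t : Transvection n) (v : V n) → dot v (functional t) ≡ true → apply t v ≡ v ⊕ direction t
apply-move t v va≡1 rewrite va≡1 = refl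

apply-involutive : (t : Transvection n) (v : V n) → apply t (apply t v) ≡ v
apply-involutive t v with dot v (functional t) in va
... | false = apply-fix t v va
... | true = trans (apply-move t (v ⊕ direction t) (dot-⊕ˡ-≡ v (direction t) (functional t) va (direction-in-kernel t)))
                   (⊕-cancelʳ v (direction t))

apply-injective : (t : Transvection n) {u v : V n} → apply t u ≡ apply t v → u ≡ v
apply-injective t {u} {v} tu≡tv =
  trans (sym (apply-involutive t u)) (trans (cong (apply t) tu≡tv) (apply-involutive t v))

apply-0 : (t : Transvection n) → apply t 0v ≡ 0v
apply-0 t = apply-fix t 0v (dot-0ˡ (functional t))

apply-⊕ : (t : Transvection n) (u v : V n) → apply t (u ⊕ v) ≡ apply t u ⊕ apply t v
apply-⊕ t u v with dot u (functional t) in ua | dot v (functional t) in va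
... | false | false = apply-fix t (u ⊕ v) (dot-⊕ˡ-≡ u v (functional t) ua va)
... | false | true = trans (apply-move t (u ⊕ v) (dot-⊕ˡ-≡ u v (functional t) ua va)) (⊕-assoc u v (direction t))
... | true | false = trans (apply-move t (u ⊕ v) (dot-⊕ˡ-≡ u v (functional t) ua va)) (⊕-swapʳ u v (direction t))
... | true | true = trans (apply-fix t (u ⊕ v) (dot-⊕ˡ-≡ u v (functional t) ua va)) (sym (⊕-cancel-common u v (direction t)))

lookup-apply : (t : Transvection n) (v : V n) (j : Fin n) →
               lookup (apply t v) j ≡ lookup v j xor (dot v (functional t) ∧ lookup (direction t) j)
lookup-apply t v j with dot v (functional t)
... | true = lookup-zipWith _xor_ j v (direction t)
... | false = sym (xor-identityʳ (lookup v j))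

matrix : Transvection n → Mat n
matrix t i j = idMat i j xor (lookup (functional t) i ∧ lookup (direction t) j)

vecMat-matrix : (t : Transvection n) (v : V n) → vecMat v (matrix t) ≡ apply t v
vecMat-matrix {n} t v = lookup-ext λ j → begin
  lookup (vecMat v (matrix t)) j
    ≡⟨ vecMat-lookup v (matrix t) j ⟩
  ∑[ i < n ] (lookup v i ∧ (idMat i j xor (a i ∧ b j)))
    ≡⟨ sum-cong-≗ (λ i → ∧-distribˡ-xor (lookup v i) (idMat i j) (a i ∧ b j)) ⟩
  ∑[ i < n ] ((lookup v i ∧ idMat i j) xor (lookup v i ∧ (a i ∧ b j)))
    ≡⟨ ∑-distrib-+ (λ i → lookup v i ∧ idMat i j) (λ i → lookup v i ∧ (a i ∧ b j)) ⟩
  ∑[ i < n ] (lookup v i ∧ idMat i j) xor ∑[ i < n ] (lookup v i ∧ (a i ∧ b j))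
    ≡⟨ cong₂ _xor_ (∑-δʳ (lookup v) j) (sum-cong-≗ (λ i → sym (∧-assoc (lookup v i) (a i) (b j)))) ⟩
  lookup v j xor ∑[ i < n ] ((lookup v i ∧ a i) ∧ b j)
    ≡⟨ cong (lookup v j xor_) (*-distribʳ-sum (b j) (λ i → lookup v i ∧ a i)) ⟨
  lookup v j xor (∑[ i < n ] (lookup v i ∧ a i) ∧ b j)
    ≡⟨ cong (λ c → lookup v j xor (c ∧ b j)) (dot-as-sum v (functional t)) ⟨
  lookup v j xor (dot v (functional t) ∧ b j)
    ≡⟨ lookup-apply t v j ⟨
  lookup (apply t v) j ∎
  where
  open ≡-Reasoning
  a b : Fin n → Bool
  a = lookup (functional t)
  b = lookup (direction t)

matrix-InGL : (t : Transvection n) → InGL (matrix t)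
matrix-InGL t = matrix t , M·M≡1 , M·M≡1
  where
  M·M≡1 : ∀ i j → (matrix t ·ₘ matrix t) i j ≡ idMat i j
  M·M≡1 = vecMat-inverse⇒·ₘ-inverse λ v →
    trans (vecMat-matrix t (vecMat v (matrix t))) (trans (cong (apply t) (vecMat-matrix t v)) (apply-involutive t v))

detecting-functional : {y : V n} → y ≢ 0v → ∃[ a ] dot y a ≡ true
detecting-functional {y = []} y≢0 = contradiction refl y≢0
detecting-functional {y = true ∷ y} _ = true ∷ 0v , cong not (dot-0ʳ y)
detecting-functional {y = false ∷ y} y≢0 = let a , ya≡1 = detecting-functional (y≢0 ∘ cong (false ∷_)) in false ∷ a , ya≡1

separating-functional : {x y : V n} → y ≢ 0v → x ≢ y → ∃[ a ] dot x a ≡ false × dot y a ≡ true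
separating-functional {x = x} {y} y≢0 x≢y with detecting-functional y≢0
... | a₁ , ya₁ with dot x a₁ in xa₁
...   | false = a₁ , xa₁ , ya₁
...   | true with detecting-functional (x≢y ∘ ⊕≡0⇒≡)
...     | a₂ , [x⊕y]a₂ with dot x a₂ in xa₂
...       | false = a₂ , xa₂ , trans (dot-by-⊕ x y a₂) (cong₂ _xor_ xa₂ [x⊕y]a₂)
...       | true = a₁ ⊕ a₂ , dot-⊕ʳ-≡ x a₁ a₂ xa₁ xa₂ ,
                   dot-⊕ʳ-≡ y a₁ a₂ ya₁ (trans (dot-by-⊕ x y a₂) (cong₂ _xor_ xa₂ [x⊕y]a₂))

OutsideSpan : V n → V n → V n → Set
OutsideSpan q r p = p ≢ 0v × p ≢ q × p ≢ r × p ≢ q ⊕ r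

annihilating-functional : {q r p : V n} → OutsideSpan q r p → ∃[ a ] dot q a ≡ false × dot r a ≡ false × dot p a ≡ true
annihilating-functional {q = q} {r} {p} (p≢0 , p≢q , p≢r , p≢q⊕r) with separating-functional p≢0 (p≢q ∘ sym)
... | a₁ , qa₁ , pa₁ with dot r a₁ in ra₁
...   | false = a₁ , qa₁ , ra₁ , pa₁
...   | true with separating-functional (p≢r ∘ ⊕≡0⇒≡) (p≢q⊕r ∘ λ q≡p⊕r → sym (trans (cong (_⊕ r) q≡p⊕r) (⊕-cancelʳ p r)))
...     | a₂ , qa₂ , [p⊕r]a₂ with dot p a₂ in pa₂
...       | true = a₂ , qa₂ , trans (dot-by-⊕ p r a₂) (cong₂ _xor_ pa₂ [p⊕r]a₂) , pa₂
...       | false = a₁ ⊕ a₂ , dot-⊕ʳ-≡ q a₁ a₂ qa₁ qa₂ ,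
                    dot-⊕ʳ-≡ r a₁ a₂ ra₁ (trans (dot-by-⊕ p r a₂) (cong₂ _xor_ pa₂ [p⊕r]a₂)) ,
                    dot-⊕ʳ-≡ p a₁ a₂ pa₁ pa₂

annihilating-functional-both : {q r p w : V n} → OutsideSpan q r p → OutsideSpan q r w →
                               ∃[ a ] dot q a ≡ false × dot r a ≡ false × dot p a ≡ true × dot w a ≡ true
annihilating-functional-both {q = q} {r} {p} {w} p∉ w∉ with annihilating-functional p∉ | annihilating-functional w∉
... | a₁ , qa₁ , ra₁ , pa₁ | a₂ , qa₂ , ra₂ , wa₂ with dot w a₁ in wa₁ | dot p a₂ in pa₂
...   | true | _ = a₁ , qa₁ , ra₁ , pa₁ , wa₁
...   | false | true = a₂ , qa₂ , ra₂ , pa₂ , wa₂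
...   | false | false = a₁ ⊕ a₂ , dot-⊕ʳ-≡ q a₁ a₂ qa₁ qa₂ , dot-⊕ʳ-≡ r a₁ a₂ ra₁ ra₂ ,
                        dot-⊕ʳ-≡ p a₁ a₂ pa₁ pa₂ , dot-⊕ʳ-≡ w a₁ a₂ wa₁ wa₂

transvection-moves : {q r p w : V n} → OutsideSpan q r p → OutsideSpan q r w →
                     ∃[ t ] apply t q ≡ q × apply t r ≡ r × apply t p ≡ w
transvection-moves {n} {q} {r} {p} {w} p∉ w∉ with annihilating-functional-both p∉ w∉
... | a , qa , ra , pa , wa = t , apply-fix t q qa , apply-fix t r ra , trans (apply-move t p pa) (⊕-cancelˡ p w)
  where
  t : Transvection n
  t = transvection a (p ⊕ w) (dot-⊕ˡ-≡ p w a pa wa)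

outside-line : {q p : V n} → p ≢ 0v → p ≢ q → OutsideSpan q q p
outside-line {q = q} p≢0 p≢q = p≢0 , p≢q , p≢q , (p≢0 ∘ λ p≡q⊕q → trans p≡q⊕q (⊕-self q))

OutsideSpan-swap : {q r p : V n} → OutsideSpan q r p → OutsideSpan r q p
OutsideSpan-swap {q = q} {r} (p≢0 , p≢q , p≢r , p≢q⊕r) =
  p≢0 , p≢r , p≢q , (p≢q⊕r ∘ λ p≡r⊕q → trans p≡r⊕q (⊕-comm r q))

OutsideSpan-apply : (t : Transvection n) {q r p : V n} → OutsideSpan q r p → OutsideSpan (apply t q) (apply t r) (apply t p)
OutsideSpan-apply t {q} {r} {p} (p≢0 , p≢q , p≢r , p≢q⊕r) =
  (λ tp≡0 → p≢0 (apply-injective t (trans tp≡0 (sym (apply-0 t))))) ,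
  (p≢q ∘ apply-injective t) ,
  (p≢r ∘ apply-injective t) ,
  (λ tp≡tq⊕tr → p≢q⊕r (apply-injective t (trans tp≡tq⊕tr (sym (apply-⊕ t q r)))))

Independent₂ : V n → V n → Set
Independent₂ u v = u ≢ 0v × v ≢ 0v × u ≢ v

Independent₃ : V n → V n → V n → Set
Independent₃ u v w = Independent₂ u v × OutsideSpan u v w

transitive-on-nonzero : {P : V n → Set} → (∀ t {u} → P u → P (apply t u)) →
                        ∀ {y u} → P y → y ≢ 0v → u ≢ 0v → P u
transitive-on-nonzero {P = P} invariant py y≢0 u≢0 =
  let t , _ , _ , ty≡u = transvection-moves (outside-line y≢0 y≢0) (outside-line u≢0 u≢0)
  in subst P ty≡u (invariant t py)

transitive-on-pairs : {P : V n → V n → Set} →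
                      (∀ t {u v} → P u v → P (apply t u) (apply t v)) → (∀ {u v} → P u v → P v u) →
                      ∀ {y z u v} → P y z → Independent₂ y z → Independent₂ u v → P u v
transitive-on-pairs {P = P} invariant symmetric {y} {z} {u} {v} pyz (y≢0 , z≢0 , y≢z) (u≢0 , v≢0 , u≢v) with u ≟ᵥ z
... | no u≢z =
  let t₁ , t₁z , _ , t₁y = transvection-moves (outside-line y≢0 y≢z) (outside-line u≢0 u≢z)
      t₂ , t₂u , _ , t₂z = transvection-moves (outside-line z≢0 (u≢z ∘ sym)) (outside-line v≢0 (u≢v ∘ sym))
  in subst₂ P t₂u t₂z (invariant t₂ (subst₂ P t₁y t₁z (invariant t₁ pyz)))
... | yes refl =
  let t , tu , _ , ty = transvection-moves (outside-line y≢0 y≢z) (outside-line v≢0 (u≢v ∘ sym))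
  in subst₂ P tu ty (invariant t (symmetric pyz))

transitive-on-bases : {P : V n → V n → V n → Set} →
                      (∀ t {u v w} → P u v w → P (apply t u) (apply t v) (apply t w)) →
                      (∀ {u v w} → P u v w → P v u w) →
                      ∀ {x y z u v w} → P x y z → Independent₃ x y z → Independent₃ u v w → P u v w
transitive-on-bases {P = P} invariant swap {z = z} {u} {v} {w} pxyz (xy , z∉) (uv , w∉) =
  let r , puvr , r∉ = transitive-on-pairs {P = λ u v → ∃[ r ] P u v r × OutsideSpan u v r}
                        (λ t (r , p , r∉) → apply t r , invariant t p , OutsideSpan-apply t r∉)
                        (λ (r , p , r∉) → r , swap p , OutsideSpan-swap r∉)
                        (z , pxyz , z∉) xy uv
      t , tu , tv , tr = transvection-moves r∉ w∉
  in subst (P u v) tr (subst₂ (λ a b → P a b (apply t r)) tu tv (invariant t puvr))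

-- Sums over V n
sumℤ-++ : (xs ys : List ℤ) → sumℤ (xs ++ ys) ≡ sumℤ xs + sumℤ ys
sumℤ-++ [] ys = sym (ℤ.+-identityˡ (sumℤ ys))
sumℤ-++ (x ∷ xs) ys = trans (cong (_+_ x) (sumℤ-++ xs ys)) (sym (ℤ.+-assoc x (sumℤ xs) (sumℤ ys)))

sumℤ-map-+ : {A : Set} (g h : A → ℤ) (xs : List A) → sumℤ (map (λ a → g a + h a) xs) ≡ sumℤ (map g xs) + sumℤ (map h xs)
sumℤ-map-+ g h [] = refl
sumℤ-map-+ g h (x ∷ xs) = trans (cong (_+_ (g x + h x)) (sumℤ-map-+ g h xs)) (+-interchange (g x) (h x) _ _)

sumℤ-map-const : {A : Set} (c : ℤ) (xs : List A) → sumℤ (map (λ _ → c) xs) ≡ + length xs * c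
sumℤ-map-const c [] = refl
sumℤ-map-const c (_ ∷ xs) = trans (cong (_+_ c) (sumℤ-map-const c xs)) (distrib c (+ length xs))
  where
  distrib : ∀ c m → c + m * c ≡ (+ 1 + m) * c
  distrib = ℤ-Solver.solve-∀

length-allV : (n : ℕ) → length (allV n) ≡ 2 ^ n
length-allV zero = refl
length-allV (suc n) = begin
  length (map (false ∷_) (allV n) ++ map (true ∷_) (allV n))
    ≡⟨ length-++ (map (false ∷_) (allV n)) ⟩
  length (map (false ∷_) (allV n)) ℕ.+ length (map (true ∷_) (allV n))
    ≡⟨ cong₂ ℕ._+_ (length-map _ (allV n)) (length-map _ (allV n)) ⟩
  length (allV n) ℕ.+ length (allV n)
    ≡⟨ cong₂ ℕ._+_ (length-allV n) (trans (length-allV n) (sym (ℕ.+-identityʳ _))) ⟩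
  2 ^ suc n ∎
  where open ≡-Reasoning

allV-complete : (v : V n) → v ∈ allV n
allV-complete [] = here refl
allV-complete {suc n} (false ∷ v) = ∈-++⁺ˡ (∈-map⁺ (false ∷_) (allV-complete v))
allV-complete {suc n} (true ∷ v) = ∈-++⁺ʳ (map (false ∷_) (allV n)) (∈-map⁺ (true ∷_) (allV-complete v))

allV-unique : (n : ℕ) → Unique (allV n)
allV-unique zero = [] ∷ []
allV-unique (suc n) = Unique.++⁺ (Unique.map⁺ ∷-injectiveʳ (allV-unique n)) (Unique.map⁺ ∷-injectiveʳ (allV-unique n)) disjoint
  where
  ∷-injectiveʳ : {x : Bool} {u v : V n} → x ∷ u ≡ x ∷ v → u ≡ v
  ∷-injectiveʳ refl = refl
  disjoint : ∀ {v} → v ∈ map (false ∷_) (allV n) × v ∈ map (true ∷_) (allV n) → ⊥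
  disjoint (v∈₀ , v∈₁) with ∈-map⁻ (false ∷_) v∈₀ | ∈-map⁻ (true ∷_) v∈₁
  ... | _ , _ , refl | _ , _ , ()

total : (V n → ℤ) → ℤ
total {n} g = sumℤ (map g (allV n))

total-cong : {g h : V n → ℤ} → g ≗ h → total g ≡ total h
total-cong {n} g≗h = cong sumℤ (map-cong g≗h (allV n))

total-+ : (g h : V n → ℤ) → total (λ a → g a + h a) ≡ total g + total h
total-+ {n} g h = sumℤ-map-+ g h (allV n)

total-const : (c : ℤ) → total {n} (λ _ → c) ≡ + 2 ^ n * c
total-const {n} c = trans (sumℤ-map-const c (allV n)) (cong (λ m → + m * c) (length-allV n))

total-zero : total {n} (λ _ → 0ℤ) ≡ 0ℤ
total-zero {n} = trans (total-const {n} 0ℤ) (ℤ.*-zeroʳ (+ 2 ^ n))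

total-suc : (g : V (suc n) → ℤ) → total g ≡ total (g ∘ (false ∷_)) + total (g ∘ (true ∷_))
total-suc {n} g = begin
  sumℤ (map g (map (false ∷_) (allV n) ++ map (true ∷_) (allV n)))     ≡⟨ cong sumℤ (map-++ g (map (false ∷_) (allV n)) _) ⟩
  sumℤ (map g (map (false ∷_) (allV n)) ++ map g (map (true ∷_) (allV n))) ≡⟨ sumℤ-++ (map g (map (false ∷_) (allV n))) _ ⟩
  sumℤ (map g (map (false ∷_) (allV n))) + sumℤ (map g (map (true ∷_) (allV n)))
    ≡⟨ cong₂ _+_ (cong sumℤ (map-∘ (allV n))) (cong sumℤ (map-∘ (allV n))) ⟨
  total (g ∘ (false ∷_)) + total (g ∘ (true ∷_))                      ∎
  where open ≡-Reasoning

pointMass : V n → ℤ → V n → ℤ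
pointMass t c a = if does (a ≟ᵥ t) then c else 0ℤ

pointMass-off : {t a : V n} (c : ℤ) → a ≢ t → pointMass t c a ≡ 0ℤ
pointMass-off {t = t} {a} c a≢t = cong (if_then c else 0ℤ) (dec-false (a ≟ᵥ t) a≢t)

total-pointMass : (t : V n) (c : ℤ) → total (pointMass t c) ≡ c
total-pointMass [] c = ℤ.+-identityʳ c
total-pointMass {suc n} (false ∷ t) c =
  trans (total-suc (pointMass (false ∷ t) c)) (trans (cong₂ _+_ (total-pointMass t c) (total-zero {n})) (ℤ.+-identityʳ c))
total-pointMass {suc n} (true ∷ t) c =
  trans (total-suc (pointMass (true ∷ t) c)) (trans (cong₂ _+_ (total-zero {n}) (total-pointMass t c)) (ℤ.+-identityˡ c))

total-perturb : {g h : V n → ℤ} (ts : List (V n)) → Unique ts → (∀ a → a ∉ ts → g a ≡ h a) →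
                total g ≡ total h + sumℤ (map (λ t → g t - h t) ts)
total-perturb [] [] agree = trans (total-cong (λ a → agree a λ ())) (sym (ℤ.+-identityʳ _))
total-perturb {n} {g} {h} (t ∷ ts) (t≢ts ∷ unique) agree = begin
  total g                                                     ≡⟨ total-perturb ts unique agree′ ⟩
  total h′ + sumℤ (map (λ s → g s - h′ s) ts)
    ≡⟨ cong₂ _+_ total-h′ (cong sumℤ (map-cong-local h′≡h-on-ts)) ⟩
  total h + (g t - h t) + sumℤ (map (λ s → g s - h s) ts)     ≡⟨ ℤ.+-assoc (total h) _ _ ⟩
  total h + sumℤ (map (λ s → g s - h s) (t ∷ ts))             ∎
  where
  open ≡-Reasoning
  h′ : V n → ℤ
  h′ a = h a + pointMass t (g t - h t) a
  total-h′ : total h′ ≡ total h + (g t - h t)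
  total-h′ = trans (total-+ h _) (cong (_+_ (total h)) (total-pointMass t (g t - h t)))
  h′-off : ∀ {s} → s ≢ t → h′ s ≡ h s
  h′-off {s} s≢t = trans (cong (_+_ (h s)) (pointMass-off (g t - h t) s≢t)) (ℤ.+-identityʳ (h s))
  h′≡h-on-ts : All (λ s → g s - h′ s ≡ g s - h s) ts
  h′≡h-on-ts = All.map (λ {s} t≢s → cong (_-_ (g s)) (h′-off (t≢s ∘ sym))) t≢ts
  agree′ : ∀ a → a ∉ ts → g a ≡ h′ a
  agree′ a a∉ts with a ≟ᵥ t
  ... | yes refl = sym (cancel (h a) (g a))
    where
    cancel : ∀ x y → x + (y - x) ≡ y
    cancel = ℤ-Solver.solve-∀
  ... | no a≢t = trans (agree a λ { (here a≡t) → a≢t a≡t ; (there a∈ts) → a∉ts a∈ts }) (sym (ℤ.+-identityʳ (h a)))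

-- Walsh transforms of indicators
⟦_⟧ : List (V n) → BF n
⟦ ts ⟧ v = does (any? (v ≟ᵥ_) ts)

⟦⟧-↭ : {xs ys : List (V n)} → xs ↭ ys → ⟦ xs ⟧ ≗ ⟦ ys ⟧
⟦⟧-↭ {xs = xs} {ys} xs↭ys v =
  does-⇔ (mk⇔ (∈-resp-↭ xs↭ys) (∈-resp-↭ (↭-sym xs↭ys))) (any? (v ≟ᵥ_) xs) (any? (v ≟ᵥ_) ys)

⟦⟧-apply : (t : Transvection n) (ts : List (V n)) → ⟦ ts ⟧ ∘ apply t ≗ ⟦ map (apply t) ts ⟧
⟦⟧-apply t ts v = does-⇔ (mk⇔ to from) (any? (apply t v ≟ᵥ_) ts) (any? (v ≟ᵥ_) (map (apply t) ts))
  where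
  to : apply t v ∈ ts → v ∈ map (apply t) ts
  to tv∈ts = subst (_∈ map (apply t) ts) (apply-involutive t v) (∈-map⁺ (apply t) tv∈ts)
  from : v ∈ map (apply t) ts → apply t v ∈ ts
  from v∈ with ∈-map⁻ (apply t) v∈
  ... | s , s∈ts , refl = subst (_∈ ts) (sym (apply-involutive t s)) s∈ts

flip-sign : ∀ b → sign (b xor true) - sign b ≡ - + 2 * sign b
flip-sign false = refl
flip-sign true = refl

W-indicator : (f : BF n) (ts : List (V n)) → Unique ts →
              W f ⟦ ts ⟧ ≡ Iq f + sumℤ (map (λ t → - + 2 * sign (f t)) ts)
W-indicator f ts unique = trans (total-perturb ts unique outside) (cong (_+_ (Iq f)) (cong sumℤ (map-cong-local inside)))
  where
  outside : ∀ a → a ∉ ts → sign (f a xor ⟦ ts ⟧ a) ≡ sign (f a)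
  outside a a∉ts = cong sign (trans (cong (f a xor_) (dec-false (any? (a ≟ᵥ_) ts) a∉ts)) (xor-identityʳ (f a)))
  inside : All (λ t → sign (f t xor ⟦ ts ⟧ t) - sign (f t) ≡ - + 2 * sign (f t)) ts
  inside = All.tabulate λ {t} t∈ts →
    trans (cong (λ b → sign (f t xor b) - sign (f t)) (dec-true (any? (t ≟ᵥ_) ts) t∈ts)) (flip-sign (f t))

sign-sum : (f : BF n) (xs : List (V n)) →
           sumℤ (map (λ a → sign (f a)) xs) ≡ + length xs - + 2 * + length (filter (λ a → f a ≟ᵇ true) xs)
sign-sum f [] = refl
sign-sum f (x ∷ xs) with f x
... | true = trans (cong (_+_ (- + 1)) (sign-sum f xs)) (step (+ length xs) (+ length (filter (λ a → f a ≟ᵇ true) xs)))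
  where
  step : ∀ l w → - + 1 + (l - + 2 * w) ≡ + 1 + l - + 2 * (+ 1 + w)
  step = ℤ-Solver.solve-∀
... | false = trans (cong (_+_ (+ 1)) (sign-sum f xs)) (step (+ length xs) (+ length (filter (λ a → f a ≟ᵇ true) xs)))
  where
  step : ∀ l w → + 1 + (l - + 2 * w) ≡ + 1 + l - + 2 * w
  step = ℤ-Solver.solve-∀

Iq-wt : (f : BF n) → Iq f ≡ + 2 ^ n - + 2 * + wt f
Iq-wt {n} f = trans (sign-sum f (allV n)) (cong (λ m → + m - + 2 * + wt f) (length-allV n))

Iq-balanced : (f : BF n) → balanced f → Iq f ≡ 0ℤ
Iq-balanced {n} f bal = begin
  Iq f                     ≡⟨ Iq-wt f ⟩
  + 2 ^ n - + 2 * + wt f   ≡⟨ cong (λ x → + 2 ^ n - x) (ℤ.pos-* 2 (wt f)) ⟨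
  + 2 ^ n - + (2 ℕ.* wt f) ≡⟨ cong (λ m → + 2 ^ n - + m) bal ⟩
  + 2 ^ n - + 2 ^ n        ≡⟨ ℤ.+-inverseʳ (+ 2 ^ n) ⟩
  0ℤ                       ∎
  where open ≡-Reasoning

W-balanced-indicator : (f : BF n) → balanced f → (ts : List (V n)) → Unique ts →
                       W f ⟦ ts ⟧ ≡ sumℤ (map (λ t → - + 2 * sign (f t)) ts)
W-balanced-indicator f bal ts unique = begin
  W f ⟦ ts ⟧                       ≡⟨ W-indicator f ts unique ⟩
  Iq f + deviation                 ≡⟨ cong (_+ deviation) (Iq-balanced f bal) ⟩
  0ℤ + deviation                   ≡⟨ ℤ.+-identityˡ deviation ⟩
  deviation                        ∎
  where
  open ≡-Reasoning
  deviation : ℤ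
  deviation = sumℤ (map (λ t → - + 2 * sign (f t)) ts)

support : BF n → List (V n)
support {n} q = filter (λ a → q a ≟ᵇ true) (allV n)

support-unique : (q : BF n) → Unique (support q)
support-unique {n} q = Unique.filter⁺ (λ a → q a ≟ᵇ true) (allV-unique n)

⟦support⟧ : (q : BF n) → q ≗ ⟦ support q ⟧
⟦support⟧ {n} q v = trans (reflect (q v)) (does-⇔ membership (q v ≟ᵇ true) (any? (v ≟ᵥ_) (support q)))
  where
  P? : Decidable (λ a → q a ≡ true)
  P? a = q a ≟ᵇ true
  membership : q v ≡ true ⇔ v ∈ support q
  membership = mk⇔ (∈-filter⁺ P? (allV-complete v)) (proj₂ ∘ ∈-filter⁻ P? {xs = allV n})
  reflect : ∀ b → b ≡ does (b ≟ᵇ true)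
  reflect false = refl
  reflect true = refl

record LinearlyEquivalent (q h : BF n) : Set where
  constructor linearly-equivalent
  field
    A    : Mat n
    A∈GL : InGL A
    h≗qA : h ≗ compose q A

LinearlyEquivalent-refl : (q : BF n) → LinearlyEquivalent q q
LinearlyEquivalent-refl q = linearly-equivalent idMat InGL-idMat λ v → cong q (sym (vecMat-identity v))

LinearlyEquivalent-≗ : {q h h′ : BF n} → h ≗ h′ → LinearlyEquivalent q h → LinearlyEquivalent q h′
LinearlyEquivalent-≗ h≗h′ (linearly-equivalent A A∈GL h≗qA) =
  linearly-equivalent A A∈GL λ v → trans (sym (h≗h′ v)) (h≗qA v)

LinearlyEquivalent-apply : {q h : BF n} (t : Transvection n) → LinearlyEquivalent q h → LinearlyEquivalent q (h ∘ apply t)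
LinearlyEquivalent-apply {q = q} t (linearly-equivalent A A∈GL h≗qA) =
  linearly-equivalent (matrix t ·ₘ A) (InGL-·ₘ (matrix-InGL t) A∈GL) λ v →
    trans (h≗qA (apply t v)) (cong q (trans (cong (λ u → vecMat u A) (sym (vecMat-matrix t v)))
                                            (sym (vecMat-assoc v (matrix t) A))))

LinearlyEquivalent-bound : {q f h : BF n} → qNearlyBent q f → LinearlyEquivalent q h → ∣ W f h ∣ ≤ ρ q
LinearlyEquivalent-bound {q = q} {f} (_ , bound) (linearly-equivalent A A∈GL h≗qA) =
  subst (λ x → ∣ x ∣ ≤ ρ q) (total-cong λ a → cong (λ b → sign (f a xor b)) (sym (h≗qA a))) (bound A A∈GL)

indicator-bound : {q f : BF n} → qNearlyBent q f → {ts : List (V n)} → Unique ts → LinearlyEquivalent q ⟦ ts ⟧ →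
                  ∣ sumℤ (map (λ t → - + 2 * sign (f t)) ts) ∣ ≤ ρ q
indicator-bound {q = q} {f} bent {ts} unique q∼ts =
  subst (λ x → ∣ x ∣ ≤ ρ q) (W-balanced-indicator f (proj₁ bent) ts unique) (LinearlyEquivalent-bound bent q∼ts)

-- The bound ρ_q
ceilSqrtSearch-≤ : ∀ N D r fuel {R} → r ≤ R → R ≤ r ℕ.+ fuel → N ≤ D ℕ.* R ℕ.* R → ceilSqrtSearch N D r fuel ≤ R
ceilSqrtSearch-≤ N D r zero r≤R _ _ = r≤R
ceilSqrtSearch-≤ N D r (suc fuel) {R} r≤R R≤r+fuel N≤DR² with N ≤ᵇ D ℕ.* r ℕ.* r in found
... | true = r≤R
... | false with r ℕ.≟ R
...   | yes refl = ⊥-elim (subst T found (ℕ.≤⇒≤ᵇ N≤DR²))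
...   | no r≢R =
  ceilSqrtSearch-≤ N D (suc r) fuel (ℕ.≤∧≢⇒< r≤R r≢R) (subst (R ≤_) (ℕ.+-suc r fuel) R≤r+fuel) N≤DR²

ceilSqrtRatio-≤ : ∀ {N D R} → R ≤ N → N ≤ D ℕ.* R ℕ.* R → ceilSqrtRatio N D ≤ R
ceilSqrtRatio-≤ {N} {D} R≤N = ceilSqrtSearch-≤ N D 0 N z≤n R≤N

2^[2n] : ∀ n → 2 ^ (2 ℕ.* n) ≡ 2 ^ n ℕ.* 2 ^ n
2^[2n] n = trans (cong (λ m → 2 ^ (n ℕ.+ m)) (ℕ.+-identityʳ n)) (ℕ.^-distribˡ-+-* 2 n n)

-- The numerator 2²ⁿ ∸ I_q² of ρ_q is supplied as N with m² = N + i², which makes the truncated subtraction exact.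
ρ-≤ : (q : BF n) {m i N r : ℕ} → 2 ^ n ≡ m → ∣ Iq q ∣ ≡ i → m ℕ.* m ≡ N ℕ.+ i ℕ.* i →
      r ≤ N → N ≤ (m ∸ 1) ℕ.* r ℕ.* r → ρ q ≤ r
ρ-≤ {n} q {m} {i} {N} 2^n≡m ∣Iq∣≡i m²≡N+i² r≤N N≤Dr² = subst (_≤ _) (sym ρ≡) (ceilSqrtRatio-≤ r≤N N≤Dr²)
  where
  open ≡-Reasoning
  ρ≡ : ρ q ≡ ceilSqrtRatio N (m ∸ 1)
  ρ≡ = cong₂ ceilSqrtRatio (begin
    2 ^ (2 ℕ.* n) ∸ ∣ Iq q ∣ ℕ.* ∣ Iq q ∣
      ≡⟨ cong₂ _∸_ (trans (2^[2n] n) (cong₂ ℕ._*_ 2^n≡m 2^n≡m)) (cong₂ ℕ._*_ ∣Iq∣≡i ∣Iq∣≡i) ⟩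
    m ℕ.* m ∸ i ℕ.* i                      ≡⟨ cong (_∸ i ℕ.* i) m²≡N+i² ⟩
    N ℕ.+ i ℕ.* i ∸ i ℕ.* i                ≡⟨ ℕ.m+n∸n≡m N (i ℕ.* i) ⟩
    N                                      ∎) (cong (_∸ 1) 2^n≡m)

Iq-value : (q : BF n) {m w : ℕ} → 2 ^ n ≡ m → wt q ≡ w → Iq q ≡ + m - + 2 * + w
Iq-value q 2^n≡m wt≡w = trans (Iq-wt q) (cong₂ (λ m w → + m - + 2 * + w) 2^n≡m wt≡w)

ρ-weight-two : (q : BF n) {j : ℕ} → 2 ^ n ≡ 8 ℕ.+ j → wt q ≡ 2 → ρ q ≤ 3
ρ-weight-two q {j} 2^n≡8+j wt≡2 =
  ρ-≤ q 2^n≡8+j (cong ∣_∣ (Iq-value q 2^n≡8+j wt≡2)) (square j)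
      (s≤s (s≤s (s≤s z≤n))) (subst (48 ℕ.+ 8 ℕ.* j ≤_) (bound j) (ℕ.m≤m+n _ (15 ℕ.+ j)))
  where
  square : ∀ j → (8 ℕ.+ j) ℕ.* (8 ℕ.+ j) ≡ (48 ℕ.+ 8 ℕ.* j) ℕ.+ (4 ℕ.+ j) ℕ.* (4 ℕ.+ j)
  square = ℕ-Solver.solve-∀
  bound : ∀ j → (48 ℕ.+ 8 ℕ.* j) ℕ.+ (15 ℕ.+ j) ≡ (7 ℕ.+ j) ℕ.* 3 ℕ.* 3
  bound = ℕ-Solver.solve-∀

ρ-weight-three : (q : BF n) {j : ℕ} → 2 ^ n ≡ 8 ℕ.+ j → wt q ≡ 3 → ρ q ≤ 5
ρ-weight-three q {j} 2^n≡8+j wt≡3 =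
  ρ-≤ q 2^n≡8+j (cong ∣_∣ (Iq-value q 2^n≡8+j wt≡3)) (square j)
      (s≤s (s≤s (s≤s (s≤s (s≤s z≤n))))) (subst (60 ℕ.+ 12 ℕ.* j ≤_) (bound j) (ℕ.m≤m+n _ (115 ℕ.+ 13 ℕ.* j)))
  where
  square : ∀ j → (8 ℕ.+ j) ℕ.* (8 ℕ.+ j) ≡ (60 ℕ.+ 12 ℕ.* j) ℕ.+ (2 ℕ.+ j) ℕ.* (2 ℕ.+ j)
  square = ℕ-Solver.solve-∀
  bound : ∀ j → (60 ℕ.+ 12 ℕ.* j) ℕ.+ (115 ℕ.+ 13 ℕ.* j) ≡ (7 ℕ.+ j) ℕ.* 5 ℕ.* 5
  bound = ℕ-Solver.solve-∀

-- Each case normalises to ± (4 + j), ± (6 + j) or ± (8 + j).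
sign-sum-nonzero : ∀ j d b₁ b₂ → + (8 ℕ.+ j) * sign d + ((sign b₁ - sign d) + ((sign b₂ - sign d) + 0ℤ)) ≢ 0ℤ
sign-sum-nonzero j false false false ()
sign-sum-nonzero j false false true ()
sign-sum-nonzero j false true false ()
sign-sum-nonzero j false true true ()
sign-sum-nonzero j true false false ()
sign-sum-nonzero j true false true ()
sign-sum-nonzero j true true false ()
sign-sum-nonzero j true true true ()

almost-constant-unbalanced : {f : BF n} {t₁ t₂ : V n} {d : Bool} {j : ℕ} → 2 ^ n ≡ 8 ℕ.+ j → t₁ ≢ t₂ →
                             (∀ a → a ≢ t₁ → a ≢ t₂ → f a ≡ d) → ¬ balanced f
almost-constant-unbalanced {n} {f} {t₁} {t₂} {d} {j} 2^n≡8+j t₁≢t₂ constant bal =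
  sign-sum-nonzero j d (f t₁) (f t₂) (begin
    + (8 ℕ.+ j) * sign d + deviation ≡⟨ cong (λ m → + m * sign d + deviation) 2^n≡8+j ⟨
    + 2 ^ n * sign d + deviation     ≡⟨ cong (_+ deviation) (total-const {n} (sign d)) ⟨
    total {n} (λ _ → sign d) + deviation ≡⟨ total-perturb (t₁ ∷ t₂ ∷ []) ((t₁≢t₂ ∷ []) ∷ [] ∷ []) agree ⟨
    Iq f                             ≡⟨ Iq-balanced f bal ⟩
    0ℤ                               ∎)
  where
  open ≡-Reasoning
  deviation : ℤ
  deviation = (sign (f t₁) - sign d) + ((sign (f t₂) - sign d) + 0ℤ)
  agree : ∀ a → a ∉ t₁ ∷ t₂ ∷ [] → sign (f a) ≡ sign d
  agree a a∉ = cong sign (constant a (a∉ ∘ here) (a∉ ∘ there ∘ here))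

-- The Fano plane
Monochromatic : Bool → Bool → Bool → Set
Monochromatic a b c = a ≡ b × b ≡ c

fanoPoint : Fin 7 → V 3
fanoPoint zero = false ∷ false ∷ true ∷ []
fanoPoint (suc zero) = false ∷ true ∷ false ∷ []
fanoPoint (suc (suc zero)) = false ∷ true ∷ true ∷ []
fanoPoint (suc (suc (suc zero))) = true ∷ false ∷ false ∷ []
fanoPoint (suc (suc (suc (suc zero)))) = true ∷ false ∷ true ∷ []
fanoPoint (suc (suc (suc (suc (suc zero))))) = true ∷ true ∷ false ∷ []
fanoPoint (suc (suc (suc (suc (suc (suc zero)))))) = true ∷ true ∷ true ∷ []

Triple : Set
Triple = Fin 7 × Fin 7 × Fin 7

triples : List Triple
triples = cartesianProduct (allFin 7) (cartesianProduct (allFin 7) (allFin 7))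

IsLine : Triple → Set
IsLine (i , j , l) = Independent₂ (fanoPoint i) (fanoPoint j) × fanoPoint i ⊕ fanoPoint j ≡ fanoPoint l

IsBasis : Triple → Set
IsBasis (i , j , l) = Independent₃ (fanoPoint i) (fanoPoint j) (fanoPoint l)

MonochromaticAt : Vec Bool 7 → Triple → Set
MonochromaticAt c (i , j , l) = Monochromatic (lookup c i) (lookup c j) (lookup c l)

independent₂? : (u v : V n) → Dec (Independent₂ u v)
independent₂? u v = ¬? (u ≟ᵥ 0v) ×-dec ¬? (v ≟ᵥ 0v) ×-dec ¬? (u ≟ᵥ v)

outsideSpan? : (q r p : V n) → Dec (OutsideSpan q r p)
outsideSpan? q r p = ¬? (p ≟ᵥ 0v) ×-dec ¬? (p ≟ᵥ q) ×-dec ¬? (p ≟ᵥ r) ×-dec ¬? (p ≟ᵥ q ⊕ r)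

isLine? : Decidable IsLine
isLine? (i , j , l) = independent₂? (fanoPoint i) (fanoPoint j) ×-dec (fanoPoint i ⊕ fanoPoint j ≟ᵥ fanoPoint l)

isBasis? : Decidable IsBasis
isBasis? (i , j , l) = independent₂? (fanoPoint i) (fanoPoint j) ×-dec outsideSpan? (fanoPoint i) (fanoPoint j) (fanoPoint l)

monochromaticAt? : (c : Vec Bool 7) → Decidable (MonochromaticAt c)
monochromaticAt? c (i , j , l) = (lookup c i ≟ᵇ lookup c j) ×-dec (lookup c j ≟ᵇ lookup c l)

-- Opaque, so that the exhaustive checks below are not unfolded again where these lemmas are used.
opaque
  monochromatic-line : (c : Vec Bool 7) → ∃[ t ] MonochromaticAt c t × IsLine t
  monochromatic-line c = satisfied (All.lookup every-colouring (allV-complete c))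
    where
    every-colouring : All (λ c → Any (λ t → MonochromaticAt c t × IsLine t) triples) (allV 7)
    every-colouring = from-yes (all? (λ c → any? (λ t → monochromaticAt? c t ×-dec isLine? t) triples) (allV 7))

  monochromatic-basis : (c : Vec Bool 7) → ∃[ t ] MonochromaticAt c t × IsBasis t
  monochromatic-basis c = satisfied (All.lookup every-colouring (allV-complete c))
    where
    every-colouring : All (λ c → Any (λ t → MonochromaticAt c t × IsBasis t) triples) (allV 7)
    every-colouring = from-yes (all? (λ c → any? (λ t → monochromaticAt? c t ×-dec isBasis? t) triples) (allV 7))

module _ {k : ℕ} where

  embed : V 3 → V (3 ℕ.+ k)
  embed x = x Vec.++ 0v

  embed-⊕ : (x y : V 3) → embed (x ⊕ y) ≡ embed x ⊕ embed y
  embed-⊕ x y = sym (trans (zipWith-++ _xor_ x 0v y 0v) (cong (x ⊕ y Vec.++_) (⊕-identityʳ 0v)))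

  embed-injective : {x y : V 3} → embed x ≡ embed y → x ≡ y
  embed-injective {x} {y} = ++-injectiveˡ x y

  embed-≢ : {x y : V 3} → x ≢ y → embed x ≢ embed y
  embed-≢ x≢y = x≢y ∘ embed-injective

  Independent₂-embed : {x y : V 3} → Independent₂ x y → Independent₂ (embed x) (embed y)
  Independent₂-embed (x≢0 , y≢0 , x≢y) = embed-≢ x≢0 , embed-≢ y≢0 , embed-≢ x≢y

  Independent₃-embed : {x y z : V 3} → Independent₃ x y z → Independent₃ (embed x) (embed y) (embed z)
  Independent₃-embed {x} {y} (xy , z≢0 , z≢x , z≢y , z≢x⊕y) =
    Independent₂-embed xy , embed-≢ z≢0 , embed-≢ z≢x , embed-≢ z≢y ,
    (embed-≢ z≢x⊕y ∘ λ e → trans e (sym (embed-⊕ x y)))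

  module _ (f : BF (3 ℕ.+ k)) where

    colouring : Vec Bool 7
    colouring = tabulate (f ∘ embed ∘ fanoPoint)

    colouring-lookup : (i : Fin 7) → lookup colouring i ≡ f (embed (fanoPoint i))
    colouring-lookup = lookup∘tabulate (f ∘ embed ∘ fanoPoint)

    colour-≡ : {i j : Fin 7} → lookup colouring i ≡ lookup colouring j → f (embed (fanoPoint i)) ≡ f (embed (fanoPoint j))
    colour-≡ {i} {j} cᵢ≡cⱼ = trans (sym (colouring-lookup i)) (trans cᵢ≡cⱼ (colouring-lookup j))

    fano-line : (∀ {u v} → Independent₂ u v → ¬ Monochromatic (f u) (f v) (f (u ⊕ v))) → ⊥
    fano-line no-line with monochromatic-line colouring
    ... | (i , j , l) , (cᵢ≡cⱼ , cⱼ≡cₗ) , (ij , pᵢ⊕pⱼ≡pₗ) = no-line (Independent₂-embed ij)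
      (colour-≡ cᵢ≡cⱼ ,
       trans (colour-≡ cⱼ≡cₗ) (cong f (trans (cong embed (sym pᵢ⊕pⱼ≡pₗ)) (embed-⊕ (fanoPoint i) (fanoPoint j)))))

    fano-basis : (∀ {u v w} → Independent₃ u v w → ¬ Monochromatic (f u) (f v) (f w)) → ⊥
    fano-basis no-basis with monochromatic-basis colouring
    ... | _ , (cᵢ≡cⱼ , cⱼ≡cₗ) , ijl = no-basis (Independent₃-embed ijl) (colour-≡ cᵢ≡cⱼ , colour-≡ cⱼ≡cₗ)

-- Weights two and three
monochromatic-pair-value : ∀ {b c} → b ≡ c → ∣ - + 2 * sign b + (- + 2 * sign c + 0ℤ) ∣ ≡ 4
monochromatic-pair-value {false} refl = refl
monochromatic-pair-value {true} refl = refl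

monochromatic-triple-value : ∀ {a b c} → Monochromatic a b c →
                             ∣ - + 2 * sign a + (- + 2 * sign b + (- + 2 * sign c + 0ℤ)) ∣ ≡ 6
monochromatic-triple-value {false} (refl , refl) = refl
monochromatic-triple-value {true} (refl , refl) = refl

module _ {k j : ℕ} (2^n≡8+j : 2 ^ (3 ℕ.+ k) ≡ 8 ℕ.+ j) where

  zero-isolated : (f : BF (3 ℕ.+ k)) → balanced f → (∀ {u} → u ≢ 0v → f u ≢ f 0v) → ⊥
  zero-isolated f bal separated =
    almost-constant-unbalanced {t₂ = true ∷ 0v} 2^n≡8+j (λ ()) (λ a a≢0 _ → ¬-not (separated a≢0)) bal

  zero-shared-once : (f : BF (3 ℕ.+ k)) → balanced f →
                     (∀ {u v} → Independent₂ u v → ¬ Monochromatic (f 0v) (f u) (f v)) → ⊥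
  zero-shared-once f bal no-mono with any? (λ u → ¬? (u ≟ᵥ 0v) ×-dec (f u ≟ᵇ f 0v)) (allV (3 ℕ.+ k))
  ... | no none = zero-isolated f bal (λ {u} u≢0 fu≡f0 → none (lose (allV-complete u) (u≢0 , fu≡f0)))
  ... | yes some with satisfied some
  ...   | u , u≢0 , fu≡f0 = almost-constant-unbalanced 2^n≡8+j (u≢0 ∘ sym)
          (λ a a≢0 a≢u → ¬-not λ fa≡f0 →
             no-mono (u≢0 , a≢0 , a≢u ∘ sym) (sym fu≡f0 , trans fu≡f0 (sym fa≡f0)))
          bal

  module _ {q f : BF (3 ℕ.+ k)} (bent : qNearlyBent q f) where

    -- A record rather than a synonym, so that ts can be inferred from InOrbit ts.
    record InOrbit (ts : List (V (3 ℕ.+ k))) : Set where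
      constructor in-orbit
      field linearly-equivalent-to-q : LinearlyEquivalent q ⟦ ts ⟧

    InOrbit-apply : (t : Transvection (3 ℕ.+ k)) {ts : List (V (3 ℕ.+ k))} → InOrbit ts → InOrbit (map (apply t) ts)
    InOrbit-apply t {ts} (in-orbit q∼ts) = in-orbit (LinearlyEquivalent-≗ (⟦⟧-apply t ts) (LinearlyEquivalent-apply t q∼ts))

    InOrbit-↭ : {xs ys : List (V (3 ℕ.+ k))} → xs ↭ ys → InOrbit xs → InOrbit ys
    InOrbit-↭ xs↭ys (in-orbit q∼xs) = in-orbit (LinearlyEquivalent-≗ (⟦⟧-↭ xs↭ys) q∼xs)

    InOrbit-support : InOrbit (support q)
    InOrbit-support = in-orbit (LinearlyEquivalent-≗ (⟦support⟧ q) (LinearlyEquivalent-refl q))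

    InOrbit-bound : {ts : List (V (3 ℕ.+ k))} → Unique ts → InOrbit ts →
                    ∣ sumℤ (map (λ t → - + 2 * sign (f t)) ts) ∣ ≤ ρ q
    InOrbit-bound unique (in-orbit q∼ts) = indicator-bound bent unique q∼ts

    Separating : Set
    Separating = ∀ {u v} → InOrbit (u ∷ v ∷ []) → u ≢ v → f u ≢ f v

    NeverMonochromatic : Set
    NeverMonochromatic =
      ∀ {u v w} → InOrbit (u ∷ v ∷ w ∷ []) → u ≢ v → u ≢ w → v ≢ w → ¬ Monochromatic (f u) (f v) (f w)

    separating : ρ q ≤ 3 → Separating
    separating ρ≤3 h u≢v fu≡fv = ℕ.<-irrefl refl (ℕ.≤-trans
      (subst (_≤ ρ q) (monochromatic-pair-value fu≡fv) (InOrbit-bound ((u≢v ∷ []) ∷ [] ∷ []) h)) ρ≤3)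

    never-monochromatic : ρ q ≤ 5 → NeverMonochromatic
    never-monochromatic ρ≤5 h u≢v u≢w v≢w mono = ℕ.<-irrefl refl (ℕ.≤-trans
      (subst (_≤ ρ q) (monochromatic-triple-value mono)
             (InOrbit-bound ((u≢v ∷ u≢w ∷ []) ∷ (v≢w ∷ []) ∷ [] ∷ []) h))
      ρ≤5)

    pair-with-zero-impossible : Separating → ∀ {y} → InOrbit (0v ∷ y ∷ []) → y ≢ 0v → ⊥
    pair-with-zero-impossible separated h y≢0 = zero-isolated f (proj₁ bent) λ u≢0 fu≡f0 →
      separated (transitive-on-nonzero {P = λ u → InOrbit (0v ∷ u ∷ [])} invariant h y≢0 u≢0) (u≢0 ∘ sym) (sym fu≡f0)
      where
      invariant : ∀ t {u} → InOrbit (0v ∷ u ∷ []) → InOrbit (0v ∷ apply t u ∷ [])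
      invariant t {u} h = subst (λ z → InOrbit (z ∷ apply t u ∷ [])) (apply-0 t) (InOrbit-apply t h)

    pair-impossible : Separating → ∀ {x y} → InOrbit (x ∷ y ∷ []) → x ≢ y → ⊥
    pair-impossible separated {x} {y} h x≢y with x ≟ᵥ 0v | y ≟ᵥ 0v
    ... | yes refl | _ = pair-with-zero-impossible separated h (x≢y ∘ sym)
    ... | no x≢0 | yes refl = pair-with-zero-impossible separated (InOrbit-↭ (↭.swap x 0v ↭.refl) h) x≢0
    ... | no x≢0 | no y≢0 = fano-line f λ uv (fu≡fv , _) →
      separated (transitive-on-pairs {P = λ u v → InOrbit (u ∷ v ∷ [])}
                  (λ t → InOrbit-apply t) (λ {u} {v} → InOrbit-↭ (↭.swap u v ↭.refl)) h (x≢0 , y≢0 , x≢y) uv)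
                (proj₂ (proj₂ uv)) fu≡fv

    triple-with-zero-impossible : NeverMonochromatic → ∀ {y z} → InOrbit (0v ∷ y ∷ z ∷ []) → Independent₂ y z → ⊥
    triple-with-zero-impossible no-mono h yz = zero-shared-once f (proj₁ bent) λ uv@(u≢0 , v≢0 , u≢v) →
      no-mono (transitive-on-pairs invariant symmetric h yz uv) (u≢0 ∘ sym) (v≢0 ∘ sym) u≢v
      where
      invariant : ∀ t {u v} → InOrbit (0v ∷ u ∷ v ∷ []) → InOrbit (0v ∷ apply t u ∷ apply t v ∷ [])
      invariant t {u} {v} h = subst (λ z → InOrbit (z ∷ apply t u ∷ apply t v ∷ [])) (apply-0 t) (InOrbit-apply t h)
      symmetric : ∀ {u v} → InOrbit (0v ∷ u ∷ v ∷ []) → InOrbit (0v ∷ v ∷ u ∷ [])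
      symmetric {u} {v} = InOrbit-↭ (↭.prep 0v (↭.swap u v ↭.refl))

    line-impossible : NeverMonochromatic → ∀ {x y} → InOrbit (x ∷ y ∷ x ⊕ y ∷ []) → Independent₂ x y → ⊥
    line-impossible no-mono h xy = fano-line f λ uv@(u≢0 , v≢0 , u≢v) →
      no-mono (transitive-on-pairs invariant symmetric h xy uv) u≢v (≢-⊕ʳ v≢0) (≢-⊕ˡ u≢0)
      where
      invariant : ∀ t {u v} → InOrbit (u ∷ v ∷ u ⊕ v ∷ []) →
                  InOrbit (apply t u ∷ apply t v ∷ apply t u ⊕ apply t v ∷ [])
      invariant t {u} {v} h = subst (λ z → InOrbit (apply t u ∷ apply t v ∷ z ∷ [])) (apply-⊕ t u v) (InOrbit-apply t h)
      symmetric : ∀ {u v} → InOrbit (u ∷ v ∷ u ⊕ v ∷ []) → InOrbit (v ∷ u ∷ v ⊕ u ∷ [])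
      symmetric {u} {v} h = subst (λ z → InOrbit (v ∷ u ∷ z ∷ [])) (⊕-comm u v) (InOrbit-↭ (↭.swap u v ↭.refl) h)

    basis-impossible : NeverMonochromatic → ∀ {x y z} → InOrbit (x ∷ y ∷ z ∷ []) → Independent₃ x y z → ⊥
    basis-impossible no-mono h xyz = fano-basis f λ uvw@((_ , _ , u≢v) , _ , w≢u , w≢v , _) →
      no-mono (transitive-on-bases {P = λ u v w → InOrbit (u ∷ v ∷ w ∷ [])} (λ t → InOrbit-apply t)
                (λ {u} {v} {w} → InOrbit-↭ (↭.swap u v ↭.refl)) h xyz uvw)
              u≢v (w≢u ∘ sym) (w≢v ∘ sym)

    triple-impossible : NeverMonochromatic → ∀ {x y z} → InOrbit (x ∷ y ∷ z ∷ []) → x ≢ y → x ≢ z → y ≢ z → ⊥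
    triple-impossible no-mono {x} {y} {z} h x≢y x≢z y≢z with x ≟ᵥ 0v | y ≟ᵥ 0v | z ≟ᵥ 0v
    ... | yes refl | _ | _ = triple-with-zero-impossible no-mono h (x≢y ∘ sym , x≢z ∘ sym , y≢z)
    ... | no x≢0 | yes refl | _ =
      triple-with-zero-impossible no-mono (InOrbit-↭ (↭.swap x 0v ↭.refl) h) (x≢0 , y≢z ∘ sym , x≢z)
    ... | no x≢0 | no y≢0 | yes refl =
      triple-with-zero-impossible no-mono
        (InOrbit-↭ (↭.trans (↭.prep x (↭.swap y 0v ↭.refl)) (↭.swap x 0v ↭.refl)) h) (x≢0 , y≢0 , x≢y)
    ... | no x≢0 | no y≢0 | no z≢0 with z ≟ᵥ x ⊕ y
    ...   | yes refl = line-impossible no-mono h (x≢0 , y≢0 , x≢y)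
    ...   | no z≢x⊕y = basis-impossible no-mono h ((x≢0 , y≢0 , x≢y) , z≢0 , x≢z ∘ sym , y≢z ∘ sym , z≢x⊕y)

    weight-two-impossible : wt q ≡ 2 → ⊥
    weight-two-impossible wt≡2 = support-is-pair (support q) (support-unique q) wt≡2 InOrbit-support
      where
      support-is-pair : (ts : List (V (3 ℕ.+ k))) → Unique ts → length ts ≡ 2 → InOrbit ts → ⊥
      support-is-pair (x ∷ y ∷ []) ((x≢y ∷ []) ∷ _) _ h = pair-impossible (separating (ρ-weight-two q 2^n≡8+j wt≡2)) h x≢y

    weight-three-impossible : wt q ≡ 3 → ⊥
    weight-three-impossible wt≡3 = support-is-triple (support q) (support-unique q) wt≡3 InOrbit-support
      where
      support-is-triple : (ts : List (V (3 ℕ.+ k))) → Unique ts → length ts ≡ 3 → InOrbit ts → ⊥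
      support-is-triple (x ∷ y ∷ z ∷ []) ((x≢y ∷ x≢z ∷ []) ∷ (y≢z ∷ []) ∷ [] ∷ []) _ h =
        triple-impossible (never-monochromatic (ρ-weight-three q 2^n≡8+j wt≡3)) h x≢y x≢z y≢z

8≤2^[3+k] : (k : ℕ) → 8 ≤ 2 ^ (3 ℕ.+ k)
8≤2^[3+k] k = subst (8 ≤_) (sym (ℕ.^-distribˡ-+-* 2 3 k)) (ℕ.*-monoʳ-≤ 8 (ℕ.m^n>0 2 k))

theorem5 : (n : ℕ) → 2 < n → (q : BF n) → (wt q ≡ 2 ⊎ wt q ≡ 3) →
    (f : BF n) → ¬ (¬ affine f × qNearlyBent q f)
theorem5 zero () _ _ _
theorem5 (suc zero) (s≤s ()) _ _ _
theorem5 (suc (suc zero)) (s≤s (s≤s ())) _ _ _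
theorem5 (suc (suc (suc k))) _ q weight f (_ , bent) =
  let j , 8+j≡2^n = ℕ.m≤n⇒∃[o]m+o≡n (8≤2^[3+k] k)
  in [ weight-two-impossible (sym 8+j≡2^n) bent , weight-three-impossible (sym 8+j≡2^n) bent ] weight
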